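{- Let $T$ be an $\mathcal{A}$-tree and let $x,y\in V(T)$ be two different nodes. If $\mathcal{A}(x)=\mathcal{A}(y)$, then there is a directed path from $x$ to $y$ or from $y$ to $x$ such that its origin and all its intermediate nodes are unlabeled and elementary.
   Context: A tree is a finite directed graph that is either empty or has a distinguished root $r$ such that for every node $v$ there is exactly one directed path from $r$ to $v$. If there is a (possibly trivial) directed path from $v$ to $w$, $w$ is a descendant of $v$. Leaves are nodes without children; a node is elementary if it has exactly one child. The intermediate nodes of a path $(v_0,\dots,v_k)$ are $v_1,\dots,v_{k-1}$ and its origin is $v_0$. Fix a set $\mathcal{A}$ of labels. An $\mathcal{A}$-tree is a tree some of whose nodes, including all leaves, are injectively labeled by elements of $\mathcal{A}$. For a node $v$, $\mathcal{A}(v)$ denotes the set of labels of all descendants of $v$, including $v$ itself. -}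

module Defs where

open import Data.Nat using (ℕ)
open import Data.Fin using (Fin)
open import Data.Bool using (Bool; true)
open import Data.Maybe using (Maybe; just; nothing)
open import Data.Product using (Σ; ∃; _×_)
open import Data.Sum using (_⊎_)
open import Relation.Binary.PropositionalEquality using (_≡_; _≢_)
open import Function.Bundles using (_⇔_)

Graph : ℕ → Set
Graph n = Fin n → Fin n → Bool

module _ {n : ℕ} (E : Graph n) where

  Edge : Fin n → Fin n → Set
  Edge u v = E u v ≡ true

  data Path : Fin n → Fin n → Set where
    []  : ∀ {v} → Path v v
    _∷_ : ∀ {u v w} → Edge u v → Path v w → Path u w

  Descendant : Fin n → Fin n → Set
  Descendant v w = Path v w

  Leaf : Fin n → Set
  Leaf v = ∀ w → E v w ≢ true

  Elementary : Fin n → Set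
  Elementary v = Σ (Fin n) λ c → Edge v c × (∀ w → Edge v w → w ≡ c)

  IsTree : Set
  IsTree = (n ≡ 0) ⊎ Σ (Fin n) λ r → ∀ v → Σ (Path r v) λ p → ∀ (q : Path r v) → q ≡ p

  -- "The origin and all intermediate nodes of the path satisfy P",
  -- i.e. for (v₀,…,v_k): P v₀ and P v_i for 0 < i < k.
  data OriginAndInner (P : Fin n → Set) : ∀ {u w} → Path u w → Set where
    trivial : ∀ {u} → P u → OriginAndInner P ([] {u})
    single  : ∀ {u w} {e : Edge u w} → P u → OriginAndInner P (e ∷ [])
    more    : ∀ {u v w x} {e : Edge u v} {e′ : Edge v w} {p : Path w x} →
              P u → OriginAndInner P (e′ ∷ p) → OriginAndInner P (e ∷ (e′ ∷ p))

record 𝒜-Tree (𝒜 : Set) : Set₁ where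
  field
    n      : ℕ
    E      : Graph n
    isTree : IsTree E
    label  : Fin n → Maybe 𝒜
    label-injective : ∀ u v (a : 𝒜) → label u ≡ just a → label v ≡ just a → u ≡ v
    leaves-labelled : ∀ v → Leaf E v → ∃ λ (a : 𝒜) → label v ≡ just a

  Node : Set
  Node = Fin n

  _∈𝒜_ : 𝒜 → Node → Set
  a ∈𝒜 v = ∃ λ w → Descendant E v w × label w ≡ just a

  Same𝒜 : Node → Node → Set
  Same𝒜 x y = ∀ (a : 𝒜) → (a ∈𝒜 x) ⇔ (a ∈𝒜 y)

  Unlabelled : Node → Set
  Unlabelled v = label v ≡ nothing

  UnlabelledElementary : Node → Set
  UnlabelledElementary v = Unlabelled v × Elementary E v

{-# OPTIONS --safe #-}
-- The tree is finite and acyclic, so some leaf ℓ lies below x; it carries a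
-- label a ∈ 𝒜(x) = 𝒜(y), and as labels are injective ℓ lies below y too.
-- Paths from the root are unique, so two nodes with a common descendant are
-- comparable, say there is a path x → … → y.  A node u before y on this path
-- cannot be labelled, for its label would lie in 𝒜(y) and put u below y,
-- closing a cycle; and any child w of u has a labelled leaf below it which
-- also lies below y, hence below the next node c of the path, so uniqueness
-- of the path from u to that leaf gives w = c.
module Submission where

open import Defs
open import Data.Product using (Σ)
open import Data.Sum using (_⊎_)
open import Relation.Binary.PropositionalEquality using (_≢_)

open import Data.Nat using (ℕ; zero; suc)
open import Data.Nat.Properties using (n<1+n)
open import Data.Fin using (Fin; zero; suc)
open import Data.Fin.Properties using (any?; <⇒notInjective)
open import Data.Bool using (true)
import Data.Bool.Properties as Bool
open import Data.Maybe using (just; nothing)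
open import Data.Product using (_,_; proj₁; proj₂; ∃; _×_)
open import Data.Sum using (inj₁; inj₂)
import Data.Sum as Sum
open import Data.Empty using (⊥; ⊥-elim)
open import Function using (_∘_)
open import Function.Bundles using (Equivalence)
open import Function.Definitions using (Injective)
open import Relation.Nullary using (yes; no)
open import Relation.Binary.PropositionalEquality
  using (_≡_; refl; sym; trans; cong; subst)

Acyclic : ∀ {n} → Graph n → Set
Acyclic E = ∀ {u v} → Edge E u v → Path E v u → ⊥

UniquePaths : ∀ {n} → Graph n → Set
UniquePaths E = ∀ {u v} (p q : Path E u v) → p ≡ q

RootOf : ∀ {n} → Graph n → Fin n → Set
RootOf E r = ∀ v → Σ (Path E r v) λ p → ∀ (q : Path E r v) → q ≡ p

module _ {n : ℕ} {E : Graph n} where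

  infixr 5 _++_

  _++_ : ∀ {u v w} → Path E u v → Path E v w → Path E u w
  []      ++ q = q
  (e ∷ p) ++ q = e ∷ (p ++ q)

  secondNode : ∀ {u w} → Path E u w → Fin n
  secondNode {u} []            = u
  secondNode (_∷_ {v = v} _ _) = v

  ∷-injectiveʳ : ∀ {u v w} {e e′ : Edge E u v} {p p′ : Path E v w} →
                 _≡_ {A = Path E u w} (e ∷ p) (e′ ∷ p′) → p ≡ p′
  ∷-injectiveʳ refl = refl

  ∷≢[] : ∀ {u v} {e : Edge E u v} {p : Path E v u} → e ∷ p ≢ []
  ∷≢[] ()

  ++-cancelˡ : ∀ {r v w} (q : Path E r v) {p p′ : Path E v w} →
               q ++ p ≡ q ++ p′ → p ≡ p′
  ++-cancelˡ []      eq = eq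
  ++-cancelˡ (e ∷ q) eq = ++-cancelˡ q (∷-injectiveʳ eq)

  ++-comparable : ∀ {r x y w} (a : Path E r x) (b : Path E x w)
                  (c : Path E r y) (d : Path E y w) →
                  a ++ b ≡ c ++ d → Path E x y ⊎ Path E y x
  ++-comparable []      b c        d eq = inj₁ c
  ++-comparable (e ∷ a) b []       d eq = inj₂ (e ∷ a)
  ++-comparable (e ∷ a) b (e′ ∷ c) d eq with refl ← cong secondNode eq =
    ++-comparable a b c d (∷-injectiveʳ eq)

  originAndInner-∷ : ∀ {P : Fin n → Set} {x v y} →
    (∀ {u w} → Path E x u → Edge E u w → Path E w y → P u) →
    (e : Edge E x v) (p : Path E v y) → OriginAndInner E P (e ∷ p)
  originAndInner-∷ P-on e []       = single (P-on [] e [])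
  originAndInner-∷ P-on e (e′ ∷ p) =
    more (P-on [] e (e′ ∷ p)) (originAndInner-∷ (P-on ∘ (e ∷_)) e′ p)

  LeafBelow : Fin n → Set
  LeafBelow v = Σ (Fin n) λ w → Path E v w × Leaf E w

  DistinctDescendants : ℕ → Fin n → Set
  DistinctDescendants k v =
    Σ (Fin k → Fin n) λ f → Injective _≡_ _≡_ f × (∀ i → Path E v (f i))

  leafBelow-or-distinctDescendants : Acyclic E → ∀ k v →
    LeafBelow v ⊎ DistinctDescendants (suc k) v
  leafBelow-or-distinctDescendants acyclic zero v =
    inj₂ ((λ _ → v) , (λ { {zero} {zero} _ → refl }) , λ _ → [])
  leafBelow-or-distinctDescendants acyclic (suc k) v
    with any? (λ w → E v w Bool.≟ true)
  ... | no noChild = inj₁ (v , [] , λ w e → noChild (w , e))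
  ... | yes (c , e) with leafBelow-or-distinctDescendants acyclic k c
  ... | inj₁ (w , p , leaf)    = inj₁ (w , e ∷ p , leaf)
  ... | inj₂ (f , f-inj , f↓) = inj₂ (g , g-inj , g↓)
    where
      g : Fin (suc (suc k)) → Fin n
      g zero    = v
      g (suc i) = f i

      g-inj : Injective _≡_ _≡_ g
      g-inj {zero}  {zero}  _  = refl
      g-inj {zero}  {suc j} eq = ⊥-elim (acyclic e (subst (Path E c) (sym eq) (f↓ j)))
      g-inj {suc i} {zero}  eq = ⊥-elim (acyclic e (subst (Path E c) eq (f↓ i)))
      g-inj {suc i} {suc j} eq = cong suc (f-inj eq)

      g↓ : ∀ i → Path E v (g i)
      g↓ zero    = []
      g↓ (suc i) = e ∷ f↓ i

  leafBelow : Acyclic E → ∀ v → LeafBelow v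
  leafBelow acyclic v with leafBelow-or-distinctDescendants acyclic n v
  ... | inj₁ below          = below
  ... | inj₂ (f , f-inj , _) = ⊥-elim (<⇒notInjective (n<1+n n) f-inj)

  uniquePaths⇒acyclic : UniquePaths E → Acyclic E
  uniquePaths⇒acyclic unique e p = ∷≢[] (unique (e ∷ p) [])

  uniquePaths⇒sameChild : UniquePaths E → ∀ {u w c z} →
    Edge E u w → Path E w z → Edge E u c → Path E c z → w ≡ c
  uniquePaths⇒sameChild unique e p e′ p′ = cong secondNode (unique (e ∷ p) (e′ ∷ p′))

  module _ {r : Fin n} (root : RootOf E r) where

    rootPath : ∀ v → Path E r v
    rootPath v = proj₁ (root v)

    root-uniquePaths : UniquePaths E
    root-uniquePaths {u} {v} p q =
      ++-cancelˡ (rootPath u) (trans (unique (rootPath u ++ p)) (sym (unique (rootPath u ++ q))))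
      where
        unique : (s : Path E r v) → s ≡ rootPath v
        unique = proj₂ (root v)

    root-comparable : ∀ {x y w} → Path E x w → Path E y w → Path E x y ⊎ Path E y x
    root-comparable {x} {y} p q =
      ++-comparable (rootPath x) p (rootPath y) q (root-uniquePaths _ _)

  rootAbove : IsTree E → Fin n → Σ (Fin n) (RootOf E)
  rootAbove (inj₂ rooted) v = rooted
  rootAbove (inj₁ refl)   ()

  module Tree (tree : IsTree E) where

    uniquePaths : UniquePaths E
    uniquePaths {u} = root-uniquePaths (proj₂ (rootAbove tree u))

    comparable : ∀ {x y w} → Path E x w → Path E y w → Path E x y ⊎ Path E y x
    comparable {x} = root-comparable (proj₂ (rootAbove tree x))

    acyclic : Acyclic E
    acyclic = uniquePaths⇒acyclic uniquePaths

module _ {𝒜 : Set} (T : 𝒜-Tree 𝒜) where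
  open 𝒜-Tree T
  open Tree isTree

  _⊆𝒜_ : Node → Node → Set
  x ⊆𝒜 y = ∀ a → a ∈𝒜 x → a ∈𝒜 y

  descendant⇒⊆𝒜 : ∀ {x u} → Path E x u → u ⊆𝒜 x
  descendant⇒⊆𝒜 x→u a (w , u→w , lw) = w , x→u ++ u→w , lw

  𝒜-nonempty : ∀ v → ∃ λ a → a ∈𝒜 v
  𝒜-nonempty v =
    let (ℓ , v→ℓ , leaf) = leafBelow acyclic v
        (a , lℓ)         = leaves-labelled ℓ leaf
    in a , ℓ , v→ℓ , lℓ

  ∈𝒜⇒descendant : ∀ {a y v} → a ∈𝒜 y → label v ≡ just a → Path E y v
  ∈𝒜⇒descendant {a} {v = v} (w , y→w , lw) lv =
    subst (Path E _) (label-injective w v a lw lv) y→w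

  ⊆𝒜⇒comparable : ∀ {x y} → x ⊆𝒜 y → Path E x y ⊎ Path E y x
  ⊆𝒜⇒comparable {x} x⊆y =
    let (a , ℓ , x→ℓ , lℓ) = 𝒜-nonempty x
    in comparable x→ℓ (∈𝒜⇒descendant (x⊆y a (ℓ , x→ℓ , lℓ)) lℓ)

  ⊆𝒜⇒unlabelled : ∀ {u w y} → u ⊆𝒜 y → Edge E u w → Path E w y → Unlabelled u
  ⊆𝒜⇒unlabelled {u} u⊆y e w→y with label u in lu
  ... | nothing = refl
  ... | just a  = ⊥-elim (acyclic e (w→y ++ ∈𝒜⇒descendant (u⊆y a (u , [] , lu)) lu))

  ⊆𝒜⇒elementary : ∀ {u c y} → u ⊆𝒜 y → Edge E u c → Path E c y → Elementary E u
  ⊆𝒜⇒elementary {c = c} u⊆y e c→y = c , e , onlyChild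
    where
      onlyChild : ∀ w → Edge E _ w → w ≡ c
      onlyChild w e′ =
        let (a , ℓ , w→ℓ , lℓ) = 𝒜-nonempty w
            y→ℓ = ∈𝒜⇒descendant (u⊆y a (ℓ , e′ ∷ w→ℓ , lℓ)) lℓ
        in uniquePaths⇒sameChild uniquePaths e′ w→ℓ e (c→y ++ y→ℓ)

  ⊆𝒜⇒originAndInner : ∀ {x y} → x ⊆𝒜 y → x ≢ y →
    (p : Path E x y) → OriginAndInner E UnlabelledElementary p
  ⊆𝒜⇒originAndInner x⊆y x≢y []      = ⊥-elim (x≢y refl)
  ⊆𝒜⇒originAndInner x⊆y x≢y (e ∷ p) = originAndInner-∷ unlabelledElementary e p
    where
      unlabelledElementary : ∀ {u w} → Path E _ u → Edge E u w → Path E w _ →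
                             UnlabelledElementary u
      unlabelledElementary x→u e′ w→y =
        let u⊆y = λ a → x⊆y a ∘ descendant⇒⊆𝒜 x→u a
        in ⊆𝒜⇒unlabelled u⊆y e′ w→y , ⊆𝒜⇒elementary u⊆y e′ w→y

corollary2 : (𝒜 : Set) (T : 𝒜-Tree 𝒜) → let open 𝒜-Tree T in
    (x y : Node) → x ≢ y → Same𝒜 x y →
    Σ (Path E x y) (OriginAndInner E UnlabelledElementary)
      ⊎ Σ (Path E y x) (OriginAndInner E UnlabelledElementary)
corollary2 𝒜 T x y x≢y same =
  Sum.map (λ p → p , ⊆𝒜⇒originAndInner T x⊆y x≢y p)
          (λ p → p , ⊆𝒜⇒originAndInner T y⊆x (x≢y ∘ sym) p)
          (⊆𝒜⇒comparable T x⊆y)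
  where
    open Equivalence
    x⊆y : _⊆𝒜_ T x y
    x⊆y a = to (same a)
    y⊆x : _⊆𝒜_ T y x
    y⊆x a = from (same a)
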